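{- Let $S=\{x_1,\dots,x_n\}\subseteq\Pi^d$, let $x^*$ be an optimal Ulam 1-median of $S$, and let $OPT=\sum_{i}\Delta(x_i,x^*)$. For each $i$ let $I_i$ be the set of symbols of $[d]$ not in a fixed longest common subsequence of $x_i$ and $x^*$ (so $\Delta(x_i,x^*)=|I_i|$), and assume the indices are ordered so that $|I_1|\le|I_2|\le\dots\le|I_n|$. Let $c_1\in(0,1]$ be a constant and let $0.0001\le\alpha\le 1$. If $|I_j|\le(1-\alpha)\cdot\frac{OPT}{n}$ for some $j\ge c_1\cdot n$, then a point $x$ chosen uniformly at random from $\{x_1,\dots,x_n\}$ satisfies $\mathrm{Obj}(S,x)\le(2-\alpha)\cdot OPT$ with probability at least $c_1$.
   Context: $\Pi^d$ is the set of permutations of $[d]$; $\Delta(x,y)=d-\mathrm{lcs}(x,y)$ is the Ulam distance, with $\mathrm{lcs}$ the length of a longest common subsequence; $\mathrm{Obj}(S,x)=\sum_{s\in S}\Delta(s,x)$; an optimal 1-median $x^*$ minimizes $\mathrm{Obj}(S,\cdot)$ over $\Pi^d$.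
   Formalization: The constants $c_1$ and α are taken to be rational numbers. -}

module Defs where

open import Data.Nat using (ℕ; zero; suc; _+_; _∸_; _⊔_; _≤_)
open import Data.Fin using (Fin)
open import Data.Fin.Properties using (_≟_)
open import Data.Fin.Permutation using (Permutation′; _⟨$⟩ʳ_)
open import Data.List using (List; []; _∷_; tabulate; length; filter)
open import Data.Nat.ListAction using (sum)
open import Data.Bool using (if_then_else_)
open import Level using (0ℓ)
open import Data.Integer using (+_)
open import Data.Rational using (ℚ; _/_)
open import Relation.Nullary using (does)
open import Relation.Nullary.Decidable using (Dec)
open import Relation.Unary using (Pred; Decidable)

Perm : ℕ → Set
Perm d = Permutation′ d

seq : {d : ℕ} → Perm d → List (Fin d)
seq {d} π = tabulate (λ i → π ⟨$⟩ʳ i)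

lcsL : {d : ℕ} → List (Fin d) → List (Fin d) → ℕ
lcsL [] ys = 0
lcsL (x ∷ xs) [] = 0
lcsL (x ∷ xs) (y ∷ ys) =
  if does (x ≟ y) then suc (lcsL xs ys) else (lcsL xs (y ∷ ys) ⊔ lcsL (x ∷ xs) ys)

lcs : {d : ℕ} → Perm d → Perm d → ℕ
lcs x y = lcsL (seq x) (seq y)

Δ : {d : ℕ} → Perm d → Perm d → ℕ
Δ {d} x y = d ∸ lcs x y

∑ : (n : ℕ) → (Fin n → ℕ) → ℕ
∑ n f = sum (tabulate f)

Obj : {d n : ℕ} → (Fin n → Perm d) → Perm d → ℕ
Obj {n = n} S x = ∑ n (λ i → Δ (S i) x)

IsOptimalMedian : {d n : ℕ} → (Fin n → Perm d) → Perm d → Set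
IsOptimalMedian {d} S x* = (y : Perm d) → Obj S x* ≤ Obj S y

count : (n : ℕ) → {P : Pred (Fin n) 0ℓ} → Decidable P → ℕ
count n P? = length (filter P? (tabulate (λ i → i)))

ℕ→ℚ : ℕ → ℚ
ℕ→ℚ n = + n / 1

-- Since Δ(x_k, x_i) ≤ Δ(x_k, x*) + Δ(x_i, x*), summing over k gives
-- Obj(S, x_i) ≤ OPT + n·Δ(x_i, x*).  For i ≤ j the hypothesis and the ordering give
-- n·Δ(x_i, x*) ≤ n·|I_j| ≤ (1 − α)·OPT, so each of the at least c₁·n samples x_1, …, x_j
-- costs at most (2 − α)·OPT.  The triangle inequality for Δ comes from lcs: two common
-- subsequences of a and c resp. b and c overlap inside c in at least
-- lcs(a,c) + lcs(b,c) − d symbols, which form a common subsequence of a and b.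
module Submission where

open import Defs

module _ where
  open import Data.Nat hiding (_≟_)
  open import Data.Nat.Properties hiding (_≟_)
  open import Data.Fin using (Fin; zero; suc)
  open import Function using (_∘_)
  open import Algebra.Properties.CommutativeSemigroup +-commutativeSemigroup using (interchange)
  open import Data.Fin.Properties using (_≟_)
  open import Data.List using (List; []; _∷_; length)
  open import Data.List.Properties using (length-tabulate)
  open import Data.List.Relation.Binary.Sublist.Propositional using (_⊆_; []; _∷_; _∷ʳ_; minimum; ⊆-trans)
  open import Data.List.Relation.Binary.Sublist.Propositional.Properties using (∷⁻; length-mono-≤)
  open import Data.Product using (∃-syntax; _×_; _,_)
  open import Data.Sum using (inj₁; inj₂)
  open import Data.Empty using (⊥-elim)
  open import Relation.Nullary using (yes; no)
  open import Relation.Binary.PropositionalEquality using (_≡_; refl; cong; subst; module ≡-Reasoning)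

  ⊆-overlap : ∀ {A : Set} {u v c : List A} → u ⊆ c → v ⊆ c →
              ∃[ w ] w ⊆ u × w ⊆ v × length u + length v ≤ length c + length w
  ⊆-overlap [] [] = [] , [] , [] , z≤n
  ⊆-overlap (y ∷ʳ p) (.y ∷ʳ q) with ⊆-overlap p q
  ... | w , wu , wv , len = w , wu , wv , m≤n⇒m≤1+n len
  ⊆-overlap {u = u} {_ ∷ v} (y ∷ʳ p) (refl ∷ q) with ⊆-overlap p q
  ... | w , wu , wv , len = w , wu , y ∷ʳ wv , ≤-trans (≤-reflexive (+-suc (length u) (length v))) (s≤s len)
  ⊆-overlap (refl ∷ p) (x ∷ʳ q) with ⊆-overlap p q
  ... | w , wu , wv , len = w , x ∷ʳ wu , wv , s≤s len
  ⊆-overlap {u = x ∷ u} {_ ∷ v} {_ ∷ c} (refl ∷ p) (refl ∷ q) with ⊆-overlap p q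
  ... | w , wu , wv , len = x ∷ w , refl ∷ wu , refl ∷ wv , s≤s (begin
    length u + suc (length v) ≡⟨ +-suc (length u) (length v) ⟩
    suc (length u + length v) ≤⟨ s≤s len ⟩
    suc (length c + length w) ≡⟨ +-suc (length c) (length w) ⟨
    length c + suc (length w) ∎)
    where open ≤-Reasoning

  HasCommonSublist : ∀ {A : Set} → ℕ → List A → List A → Set
  HasCommonSublist k xs ys = ∃[ zs ] zs ⊆ xs × zs ⊆ ys × k ≤ length zs

  HasCommonSublist-⊔ : ∀ {A : Set} {a b} {xs ys : List A} →
    HasCommonSublist a xs ys → HasCommonSublist b xs ys → HasCommonSublist (a ⊔ b) xs ys
  HasCommonSublist-⊔ {a = a} {b} (us , p , q , a≤) (vs , p′ , q′ , b≤) with ≤-total a b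
  ... | inj₁ a≤b = vs , p′ , q′ , ⊔-lub (≤-trans a≤b b≤) b≤
  ... | inj₂ b≤a = us , p , q , ⊔-lub a≤ (≤-trans b≤a a≤)

  HasCommonSublist-∷ : ∀ {A : Set} {k} x {xs ys : List A} →
    HasCommonSublist k xs ys → HasCommonSublist (suc k) (x ∷ xs) (x ∷ ys)
  HasCommonSublist-∷ x (zs , p , q , r) = x ∷ zs , refl ∷ p , refl ∷ q , s≤s r

  HasCommonSublist-∷ʳˡ : ∀ {A : Set} {k} x {xs ys : List A} →
    HasCommonSublist k xs ys → HasCommonSublist k (x ∷ xs) ys
  HasCommonSublist-∷ʳˡ x (zs , p , q , r) = zs , x ∷ʳ p , q , r

  HasCommonSublist-∷ʳʳ : ∀ {A : Set} {k} y {xs ys : List A} →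
    HasCommonSublist k xs ys → HasCommonSublist k xs (y ∷ ys)
  HasCommonSublist-∷ʳʳ y (zs , p , q , r) = zs , p , y ∷ʳ q , r

  lcsL-common : ∀ {d} (xs ys : List (Fin d)) → HasCommonSublist (lcsL xs ys) xs ys
  lcsL-common [] ys = [] , [] , minimum ys , z≤n
  lcsL-common (x ∷ xs) [] = [] , minimum (x ∷ xs) , [] , z≤n
  lcsL-common (x ∷ xs) (y ∷ ys) =
    step (lcsL-common xs ys) (lcsL-common xs (y ∷ ys)) (lcsL-common (x ∷ xs) ys)
    where
    step : HasCommonSublist (lcsL xs ys) xs ys →
           HasCommonSublist (lcsL xs (y ∷ ys)) xs (y ∷ ys) →
           HasCommonSublist (lcsL (x ∷ xs) ys) (x ∷ xs) ys →
           HasCommonSublist (lcsL (x ∷ xs) (y ∷ ys)) (x ∷ xs) (y ∷ ys)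
    step both left right with x ≟ y
    ... | yes refl = HasCommonSublist-∷ x both
    ... | no _ = HasCommonSublist-⊔ (HasCommonSublist-∷ʳˡ x left) (HasCommonSublist-∷ʳʳ y right)

  lcsL-maximal : ∀ {d} (xs ys : List (Fin d)) {zs} → zs ⊆ xs → zs ⊆ ys → length zs ≤ lcsL xs ys
  lcsL-maximal [] _ [] _ = z≤n
  lcsL-maximal (_ ∷ _) [] _ [] = z≤n
  lcsL-maximal (x ∷ xs) (y ∷ ys) p q with x ≟ y
  lcsL-maximal (x ∷ xs) (y ∷ ys) {[]} p q | yes refl = z≤n
  lcsL-maximal (x ∷ xs) (y ∷ ys) {_ ∷ _} p q | yes refl = s≤s (lcsL-maximal xs ys (∷⁻ p) (∷⁻ q))
  lcsL-maximal (x ∷ xs) (y ∷ ys) (.x ∷ʳ p) q | no _ =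
    ≤-trans (lcsL-maximal xs (y ∷ ys) p q) (m≤m⊔n _ _)
  lcsL-maximal (x ∷ xs) (y ∷ ys) (refl ∷ p) (.y ∷ʳ q) | no _ =
    ≤-trans (lcsL-maximal (x ∷ xs) ys (refl ∷ p) q) (m≤n⊔m _ _)
  lcsL-maximal (x ∷ xs) (y ∷ ys) (refl ∷ p) (refl ∷ q) | no x≢x = ⊥-elim (x≢x refl)

  lcsL≤length : ∀ {d} (xs ys : List (Fin d)) → lcsL xs ys ≤ length xs
  lcsL≤length xs ys with lcsL-common xs ys
  ... | _ , p , _ , r = ≤-trans r (length-mono-≤ p)

  lcsL-overlap : ∀ {d} (a b c : List (Fin d)) → lcsL a c + lcsL b c ≤ length c + lcsL a b
  lcsL-overlap a b c with lcsL-common a c | lcsL-common b c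
  ... | u , ua , uc , r | v , vb , vc , r′ with ⊆-overlap uc vc
  ...   | w , wu , wv , len = begin
    lcsL a c + lcsL b c  ≤⟨ +-mono-≤ r r′ ⟩
    length u + length v  ≤⟨ len ⟩
    length c + length w  ≤⟨ +-monoʳ-≤ (length c) (lcsL-maximal a b (⊆-trans wu ua) (⊆-trans wv vb)) ⟩
    length c + lcsL a b  ∎
    where open ≤-Reasoning

  ∸-triangle : ∀ {d a b c} → b ≤ d → c ≤ d → b + c ≤ d + a → d ∸ a ≤ (d ∸ b) + (d ∸ c)
  ∸-triangle {d} {a} {b} {c} b≤d c≤d b+c≤d+a = begin
    d ∸ a                  ≡⟨ [m+n]∸[m+o]≡n∸o d d a ⟨
    (d + d) ∸ (d + a)      ≤⟨ ∸-monoʳ-≤ (d + d) b+c≤d+a ⟩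
    (d + d) ∸ (b + c)      ≡⟨ ∸-+-assoc (d + d) b c ⟨
    (d + d) ∸ b ∸ c        ≡⟨ cong (_∸ c) (+-∸-comm d b≤d) ⟩
    ((d ∸ b) + d) ∸ c      ≡⟨ +-∸-assoc (d ∸ b) c≤d ⟩
    (d ∸ b) + (d ∸ c)      ∎
    where open ≤-Reasoning

  length-seq : ∀ {d} (x : Perm d) → length (seq x) ≡ d
  length-seq x = length-tabulate _

  lcs≤dim : ∀ {d} (x y : Perm d) → lcs x y ≤ d
  lcs≤dim x y = subst (lcs x y ≤_) (length-seq x) (lcsL≤length (seq x) (seq y))

  Δ-triangle : ∀ {d} (a b c : Perm d) → Δ a b ≤ Δ a c + Δ b c
  Δ-triangle a b c = ∸-triangle (lcs≤dim a c) (lcs≤dim b c)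
    (subst (λ k → lcs a c + lcs b c ≤ k + lcs a b) (length-seq c) (lcsL-overlap (seq a) (seq b) (seq c)))

  ∑-mono-≤ : ∀ n {f g : Fin n → ℕ} → (∀ k → f k ≤ g k) → ∑ n f ≤ ∑ n g
  ∑-mono-≤ zero f≤g = z≤n
  ∑-mono-≤ (suc n) f≤g = +-mono-≤ (f≤g zero) (∑-mono-≤ n (f≤g ∘ suc))

  ∑-+-const : ∀ n (g : Fin n → ℕ) c → ∑ n (λ k → g k + c) ≡ ∑ n g + n * c
  ∑-+-const zero g c = refl
  ∑-+-const (suc n) g c = begin
    (g zero + c) + ∑ n (λ k → g (suc k) + c) ≡⟨ cong ((g zero + c) +_) (∑-+-const n (g ∘ suc) c) ⟩
    (g zero + c) + (∑ n (g ∘ suc) + n * c)   ≡⟨ interchange (g zero) c (∑ n (g ∘ suc)) (n * c) ⟩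
    (g zero + ∑ n (g ∘ suc)) + (c + n * c)   ∎
    where open ≡-Reasoning

  Obj≤Obj+n*Δ : ∀ {d n} (S : Fin n → Perm d) (y x : Perm d) → Obj S y ≤ Obj S x + n * Δ y x
  Obj≤Obj+n*Δ {n = n} S y x = begin
    ∑ n (λ k → Δ (S k) y)          ≤⟨ ∑-mono-≤ n (λ k → Δ-triangle (S k) y x) ⟩
    ∑ n (λ k → Δ (S k) x + Δ y x)  ≡⟨ ∑-+-const n (λ k → Δ (S k) x) (Δ y x) ⟩
    Obj S x + n * Δ y x            ∎
    where open ≤-Reasoning

module _ where
  open import Data.Nat using (suc; _≤_; z≤n; s≤s)
  open import Data.Fin using (Fin; zero; suc; toℕ)
  open import Data.List using (tabulate; length; filter)
  open import Data.List.Properties using (filter-accept)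
  open import Function using (_∘_)
  open import Relation.Unary using (Pred; Decidable)

  prefix≤length-filter-tabulate : ∀ {a p} {A : Set a} {n} (f : Fin n → A) {P : Pred A p}
    (P? : Decidable P) (j : Fin n) → (∀ i → toℕ i ≤ toℕ j → P (f i)) →
    suc (toℕ j) ≤ length (filter P? (tabulate f))
  prefix≤length-filter-tabulate {n = suc _} f P? j Pf
    rewrite filter-accept P? {xs = tabulate (f ∘ suc)} (Pf zero z≤n) with j
  ... | zero = s≤s z≤n
  ... | suc j = s≤s (prefix≤length-filter-tabulate (f ∘ suc) P? j (λ i i≤j → Pf (suc i) (s≤s i≤j)))

open import Data.Nat using (ℕ; suc) renaming (_≤_ to _≤ₙ_)
open import Data.Fin using (Fin; toℕ)
open import Data.Product using (Σ; _×_; _,_)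
open import Function.Definitions using (Injective)
open import Relation.Binary.PropositionalEquality using (_≡_)
open import Data.Integer using (+_)
open import Data.Rational using (ℚ; _/_; _*_; _-_; _<_; _≤_; 0ℚ; 1ℚ)
open import Data.Rational.Properties using (_≤?_)
import Data.Nat as ℕ
import Data.Nat.Properties as ℕ
import Data.Rational.Properties as ℚ

module _ where
  import Data.Integer as ℤ
  import Data.Integer.Properties as ℤ
  open import Data.Nat.Coprimality using (Coprime; 1-coprimeTo)
  open import Data.Rational using (mkℚ; *≤*; _+_; -_)
  open import Data.Rational.Properties
    using (normalize-coprime; +-monoʳ-≤; +-assoc; *-distribʳ-+; *-identityˡ)
  open import Relation.Binary.PropositionalEquality using (sym; cong; cong₂; module ≡-Reasoning)

  coprimeTo-1 : ∀ n → Coprime n 1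
  coprimeTo-1 n = Data.Nat.Coprimality.sym (1-coprimeTo n)

  ℕ→ℚ≡mkℚ : ∀ n → ℕ→ℚ n ≡ mkℚ (+ n) 0 (coprimeTo-1 n)
  ℕ→ℚ≡mkℚ n = normalize-coprime (coprimeTo-1 n)

  ℕ→ℚ-+ : ∀ a b → ℕ→ℚ (a ℕ.+ b) ≡ ℕ→ℚ a + ℕ→ℚ b
  ℕ→ℚ-+ a b rewrite ℕ→ℚ≡mkℚ a | ℕ→ℚ≡mkℚ b =
    cong (_/ 1) (sym (cong₂ ℤ._+_ (ℤ.*-identityʳ (+ a)) (ℤ.*-identityʳ (+ b))))

  ℕ→ℚ-* : ∀ a b → ℕ→ℚ (a ℕ.* b) ≡ ℕ→ℚ a * ℕ→ℚ b
  ℕ→ℚ-* a b rewrite ℕ→ℚ≡mkℚ a | ℕ→ℚ≡mkℚ b = cong (_/ 1) (ℤ.pos-* a b)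

  ℕ→ℚ-mono-≤ : ∀ {a b} → a ≤ₙ b → ℕ→ℚ a ≤ ℕ→ℚ b
  ℕ→ℚ-mono-≤ {a} {b} a≤b rewrite ℕ→ℚ≡mkℚ a | ℕ→ℚ≡mkℚ b = *≤* (ℤ.*-monoʳ-≤-nonNeg (+ 1) (ℤ.+≤+ a≤b))

  o+[1-α]o≡[2-α]o : ∀ α o → o + (1ℚ - α) * o ≡ (+ 2 / 1 - α) * o
  o+[1-α]o≡[2-α]o α o = begin
    o + (1ℚ - α) * o          ≡⟨ cong (_+ (1ℚ - α) * o) (*-identityˡ o) ⟨
    1ℚ * o + (1ℚ - α) * o     ≡⟨ *-distribʳ-+ o 1ℚ (1ℚ - α) ⟨
    (1ℚ + (1ℚ - α)) * o       ≡⟨ cong (_* o) (+-assoc 1ℚ 1ℚ (- α)) ⟨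
    (+ 2 / 1 - α) * o         ∎
    where open ≡-Reasoning

  ≤o+nδ⇒ℕ→ℚ≤[2-α]o : ∀ {m o n δ} α → m ≤ₙ o ℕ.+ n ℕ.* δ → ℕ→ℚ n * ℕ→ℚ δ ≤ (1ℚ - α) * ℕ→ℚ o →
                 ℕ→ℚ m ≤ (+ 2 / 1 - α) * ℕ→ℚ o
  ≤o+nδ⇒ℕ→ℚ≤[2-α]o {m} {o} {n} {δ} α m≤o+nδ nδ≤[1-α]o = begin
    ℕ→ℚ m                      ≤⟨ ℕ→ℚ-mono-≤ m≤o+nδ ⟩
    ℕ→ℚ (o ℕ.+ n ℕ.* δ)        ≡⟨ ℕ→ℚ-+ o (n ℕ.* δ) ⟩
    ℕ→ℚ o + ℕ→ℚ (n ℕ.* δ)      ≡⟨ cong (λ q → ℕ→ℚ o + q) (ℕ→ℚ-* n δ) ⟩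
    ℕ→ℚ o + ℕ→ℚ n * ℕ→ℚ δ      ≤⟨ +-monoʳ-≤ (ℕ→ℚ o) nδ≤[1-α]o ⟩
    ℕ→ℚ o + (1ℚ - α) * ℕ→ℚ o   ≡⟨ o+[1-α]o≡[2-α]o α (ℕ→ℚ o) ⟩
    (+ 2 / 1 - α) * ℕ→ℚ o      ∎
    where open ℚ.≤-Reasoning

lemma7 : (d n : ℕ) (S : Fin n → Perm d) → Injective _≡_ _≡_ S →
    (x* : Perm d) → IsOptimalMedian S x* →
    (∀ i k → toℕ i ≤ₙ toℕ k → Δ (S i) x* ≤ₙ Δ (S k) x*) →
    (c₁ α : ℚ) → 0ℚ < c₁ → c₁ ≤ 1ℚ → (+ 1 / 10000) ≤ α → α ≤ 1ℚ →
    (Σ (Fin n) λ j → (c₁ * ℕ→ℚ n ≤ ℕ→ℚ (suc (toℕ j)))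
      × (ℕ→ℚ n * ℕ→ℚ (Δ (S j) x*) ≤ (1ℚ - α) * ℕ→ℚ (Obj S x*))) →
    c₁ * ℕ→ℚ n ≤ ℕ→ℚ (count n (λ i → ℕ→ℚ (Obj S (S i)) ≤? ((+ 2 / 1) - α) * ℕ→ℚ (Obj S x*)))
lemma7 d n S _ x* _ Δ-mono c₁ α _ _ _ _ (j , c₁n≤j+1 , nΔⱼ≤[1-α]OPT) =
  ℚ.≤-trans c₁n≤j+1 (ℕ→ℚ-mono-≤ (prefix≤length-filter-tabulate (λ i → i) _ j cheap))
  where
  cheap : ∀ i → toℕ i ≤ₙ toℕ j → ℕ→ℚ (Obj S (S i)) ≤ (+ 2 / 1 - α) * ℕ→ℚ (Obj S x*)
  cheap i i≤j = ≤o+nδ⇒ℕ→ℚ≤[2-α]o {o = Obj S x*} {n} {Δ (S j) x*} α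
    (ℕ.≤-trans (Obj≤Obj+n*Δ S (S i) x*) (ℕ.+-monoʳ-≤ (Obj S x*) (ℕ.*-monoʳ-≤ n (Δ-mono i j i≤j))))
    nΔⱼ≤[1-α]OPT
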